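{- Let $G=(V,E)$ be a map with a simple dual $G^*=(V^*,E^*)$, and let $K\subset E$ be a dual-separating set of edges. Let $X_f\subset V^*$ be a set of vertices of $G^*$ (i.e. faces of $G$) such that $K^*=E[X_f,V^*\setminus X_f]$, and write $X_f^c=V^*\setminus X_f$. Then: (i) every $e\in K$ is incident with one face in $X_f$ and one face in $X_f^c$; (ii) if $v,v'\notin V(K)$ with $v\in V(X_f)$ and $v'\in V(X_f^c)$, then there is no path in $G$ from $v$ to $v'$ without vertices in $V(K)$; so if such $v,v'$ exist, $V(K)$ is a cut-set of $G$; (iii) $K$ can be decomposed into cyclic directed walks $Z_1,\dots,Z_m$, which are facial walks in the components of the graph formed by $K$ with the embedding induced by $G$, such that the set $\{e\in E(X_f)\mid e\cap V(K)\neq\emptyset\}$ is exactly $K$ together with all edges $e$ for which there is an angle $(e',e'')$ in one of $Z_1,\dots,Z_m$ such that $e$ comes after the inverse of $e'$ and before $e''$ in the cyclic rotational order around the endpoint of $e'$ (informally: all edges on the left of and incident to $Z_1,\dots,Z_m$); (iv) $|V(K)|\le |K|$.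
   Context: A map is a simple connected graph with a cellular embedding in a closed orientable surface, described by a rotation system: each edge is represented by two oppositely oriented edges, and at each vertex a cyclic (clockwise) order of the oriented edges starting there is given. Facial walks are obtained by following an oriented edge $e$, then taking as next edge the successor, in the rotation at its end vertex, of the inverse of $e$, until returning to the start; the face lies on the left of its facial walk. An angle of a cyclic directed walk $e_1,\dots,e_k=e_1$ is a pair $(e_i,e_{i+1})$. The dual $G^*$ has the faces of $G$ as vertices and, for each edge $e$ of $G$, an edge $e^*$ joining the faces on the two sides of $e$; for a set $K$ of edges, $K^*=\{e^*: e\in K\}$. $G^*$ is simple if it has no loops or multiple edges. For disjoint vertex sets $X,Y$, $E[X,Y]$ is the set of edges with one end in $X$ and one in $Y$; $E[X,V\setminus X]$ is an edge cut. A set $K\subseteq E$ is dual-separating if $K^*$ is an edge cut of $G^*$. For a set $Y$ of faces, $V(Y)$ is the set of vertices lying on edges of faces in $Y$ and $E(Y)$ is the set of edges of faces in $Y$; for a set $K$ of edges, $V(K)$ is the set of endpoints of edges in $K$. A cut-set is a set of vertices whose removal disconnects the graph. -}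

module Defs where

open import Data.Nat using (ℕ; zero; suc; _<_; _≤_; _<?_)
open import Data.Fin using (Fin; toℕ; _≟_)
open import Data.Fin.Subset using (Subset; _∈_; _∉_; ∣_∣)
open import Data.Fin.Subset.Properties using (_∈?_)
open import Data.List using (List; length; filter; allFin)
open import Data.Product using (Σ; ∃; ∃-syntax; _×_; _,_)
open import Data.Sum using (_⊎_)
open import Relation.Nullary using (¬_)
open import Relation.Nullary.Decidable using (_×-dec_)
open import Relation.Binary.PropositionalEquality using (_≡_; _≢_)
open import Function.Bundles using (_⇔_)
open import Function.Definitions using (Injective)

iter : ∀ {A : Set} → (A → A) → ℕ → A → A
iter f zero    x = x
iter f (suc k) x = f (iter f k x)

-- A map (simple connected graph with a rotation system on an orientable
-- surface), given combinatorially.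
--   * vertices   : Fin n
--   * oriented edges (darts) : Fin d ; every edge = {e , inv e}
--   * tail e     : the vertex where the oriented edge e starts
--   * rot        : the clockwise rotation; rot e is the successor of e in
--                  the cyclic order of oriented edges starting at tail e
--   * faces      : Fin nf ; face e is the face on the left of e, i.e. the
--                  face whose facial walk contains e.  The facial walk
--                  successor of e is  rot (inv e)  (successor, in the
--                  rotation at the end of e, of the inverse of e).

record Map : Set where
  field
    n d nf : ℕ
    tail : Fin d → Fin n
    inv  : Fin d → Fin d
    rot  : Fin d → Fin d
    face : Fin d → Fin nf

  head : Fin d → Fin n
  head e = tail (inv e)

  φ : Fin d → Fin d
  φ e = rot (inv e)

  field
    inv-invol : ∀ e → inv (inv e) ≡ e
    no-loop   : ∀ e → head e ≢ tail e
    no-multi  : ∀ e e' → tail e ≡ tail e' → head e ≡ head e' → e ≡ e'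
    rot-inj   : Injective _≡_ _≡_ rot
    rot-tail  : ∀ e → tail (rot e) ≡ tail e
    rot-cyc   : ∀ e e' → tail e ≡ tail e' → ∃[ k ] iter rot k e ≡ e'
    face-orb  : ∀ e e' → (face e ≡ face e') ⇔ (∃[ k ] iter φ k e ≡ e')
    face-surj : ∀ (f : Fin nf) → ∃[ e ] face e ≡ f




module _ (M : Map) where
  open Map M

  data Walk : Fin n → Fin n → Set where
    []  : ∀ {v} → Walk v v
    _∷_ : ∀ {w} (e : Fin d) → Walk (head e) w → Walk (tail e) w

  data AllVerts (P : Fin n → Set) : ∀ {u w} → Walk u w → Set where
    []  : ∀ {v} → P v → AllVerts P ([] {v})
    _∷_ : ∀ {w e} {p : Walk (head e) w} → P (tail e) → AllVerts P p → AllVerts P (e ∷ p)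

  Connected : Set
  Connected = ∀ u v → Walk u v

  DualSimple : Set
  DualSimple =
    (∀ e → face e ≢ face (inv e)) ×
    (∀ e e' → face e ≡ face e' → face (inv e) ≡ face (inv e') → e ≡ e')

  -- a set of edges, given as a set of oriented edges closed under inverse
  EdgeSet : Subset d → Set
  EdgeSet K = ∀ e → (e ∈ K) ⇔ (inv e ∈ K)

  -- K* = E[X, V* \ X] : e* joins face e and face (inv e)
  DualCut : Subset d → Subset nf → Set
  DualCut K X = ∀ e → (e ∈ K) ⇔
    ((face e ∈ X × face (inv e) ∉ X) ⊎ (face e ∉ X × face (inv e) ∈ X))

  DualSeparating : Subset d → Set
  DualSeparating K = ∃[ X ] DualCut K X

  InVK : Subset d → Fin n → Set
  InVK K v = ∃[ e ] (e ∈ K × (tail e ≡ v ⊎ head e ≡ v))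

  InVF : Subset nf → Fin n → Set
  InVF Y v = ∃[ e ] (face e ∈ Y × (tail e ≡ v ⊎ head e ≡ v))

  InEF : Subset nf → Fin d → Set
  InEF Y e = face e ∈ Y ⊎ face (inv e) ∈ Y

  -- |K| : number of edges of K (each edge counted once, via the
  -- oriented edge with smaller index)
  numEdges : Subset d → ℕ
  numEdges K = length (filter (λ e → (e ∈? K) ×-dec (toℕ e <? toℕ (inv e))) (allFin d))

  IsCutSet : (Fin n → Set) → Set
  IsCutSet S = ∃[ u ] ∃[ w ] (¬ S u × ¬ S w ×
    ¬ (Σ (Walk u w) λ p → AllVerts (λ x → ¬ S x) p))

  -- Rotation in the graph formed by K with the induced embedding:
  -- rot^k e is the first oriented edge of K after e (k ≥ 1) in the
  -- rotation at tail e.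
  RotKSteps : Subset d → Fin d → ℕ → Set
  RotKSteps K e k = 0 < k × iter rot k e ∈ K ×
    (∀ i → 0 < i → i < k → iter rot i e ∉ K)

  -- (e' , e'') is an angle of a facial walk of the graph formed by K:
  -- e'' is the successor in the induced rotation of inv e'.
  AngleK : Subset d → Fin d → Fin d → Set
  AngleK K e' e'' = e' ∈ K × ∃[ k ] (RotKSteps K (inv e') k × iter rot k (inv e') ≡ e'')

  -- the oriented edge e comes strictly after inv e' and before e'' in the
  -- cyclic rotation at the end vertex of e', where (e' , e'') is an angle
  Between : Subset d → Fin d → Fin d → Fin d → Set
  Between K e' e'' e = e' ∈ K × ∃[ k ] ∃[ j ] (RotKSteps K (inv e') k ×
    iter rot k (inv e') ≡ e'' × 0 < j × j < k × iter rot j (inv e') ≡ e)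

{-# OPTIONS --safe #-}
module Submission where

-- Colour each dart by whether the face on its left lies in X.  As K* = E[X, V* \ X], reversing
-- a dart changes its colour exactly when it belongs to K; and the face on the left of rot e is
-- the face on the left of inv e, so turning past a dart not in K in the rotation keeps the
-- colour.  Hence the colour is constant around every vertex outside V(K) and along walks
-- avoiding V(K), which gives (ii).  Around a vertex of V(K) the darts of K alternate in colour,
-- so the set Z of darts of K with their left face in X orients each edge of K once and is
-- closed under the angles of the faces of K; a dart not in K near K inherits the colour of the
-- angle it lies in, giving (iii).  Finally every vertex of V(K) is the tail of a dart of Z,
-- and Z has |K| elements, giving (iv).

open import Defs
open import Data.Nat using (ℕ; zero; suc; _≤_; _<_; _<?_; z≤n; s≤s; z<s)
open import Data.Nat.Properties using (≤-refl; ≤-trans; <⇒≤; n≤1+n; <-cmp; ≰⇒>; m<1+n⇒m<n∨m≡n)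
open import Data.Bool using (Bool; true; false; not; if_then_else_)
open import Data.Bool.Properties using (¬-not)
open import Data.Fin using (Fin; toℕ; _≟_)
open import Data.Fin.Properties using (toℕ-injective)
open import Data.Fin.Subset using (Subset; _∈_; _∉_; _⊆_; ∁; ∣_∣; _∩_; inside; outside)
open import Data.Fin.Subset.Properties using (_∈?_; x∈∁p⇒x∉p; x∉p⇒x∈∁p; x∈p∩q⁺; x∈p∩q⁻)
open import Data.Vec using ([]; _∷_; lookup; tabulate)
open import Data.Vec.Properties using ([]=⇒lookup; lookup⇒[]=; lookup∘tabulate)
open import Data.List using (List; length; filter; allFin; map)
  renaming (tabulate to tabulateˡ)
open import Data.List.Properties using (filter-notAll; length-map)
open import Data.List.Relation.Unary.Any using (here; there)
import Data.List.Relation.Unary.Any as Any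
import Data.List.Relation.Unary.All as All
open import Data.List.Relation.Unary.AllPairs using (_∷_)
open import Data.List.Relation.Unary.Unique.Propositional using (Unique)
open import Data.List.Relation.Unary.Unique.Propositional.Properties using (filter⁺; allFin⁺)
open import Data.List.Membership.Propositional using () renaming (_∈_ to _∈ˡ_)
open import Data.List.Membership.Propositional.Properties using (∈-filter⁺; ∈-filter⁻; ∈-allFin; ∈-map⁺)
open import Data.Product using (Σ; ∃; ∃-syntax; _×_; _,_; proj₁; proj₂)
open import Data.Sum using (_⊎_; inj₁; inj₂)
open import Relation.Nullary using (¬_; yes; no; ¬?; contradiction)
open import Relation.Nullary.Decidable using (_×-dec_)
open import Relation.Unary using (Decidable)
open import Relation.Binary.Definitions using (DecidableEquality; tri<; tri≈; tri>)
open import Relation.Binary.PropositionalEquality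
open import Function using (_∘_; id)
open import Function.Bundles using (_⇔_; Equivalence; mk⇔)

open Equivalence using (to; from)

module _ {a} {A : Set a} (_≟ᴬ_ : DecidableEquality A) where

  Unique-⊆⇒length≤ : ∀ {xs ys : List A} → Unique xs → (∀ {z} → z ∈ˡ xs → z ∈ˡ ys) →
                     length xs ≤ length ys
  Unique-⊆⇒length≤ {List.[]} _ _ = z≤n
  Unique-⊆⇒length≤ {x List.∷ xs} {ys} (x∉xs ∷ xs-unique) xs⊆ys =
    ≤-trans (s≤s (Unique-⊆⇒length≤ xs-unique xs⊆ys-x))
            (filter-notAll x≢? ys (Any.map (λ x≡y x≢y → x≢y x≡y) (xs⊆ys (here refl))))
    where
    x≢? : Decidable (λ y → ¬ x ≡ y)
    x≢? y = ¬? (x ≟ᴬ y)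
    xs⊆ys-x : ∀ {z} → z ∈ˡ xs → z ∈ˡ filter x≢? ys
    xs⊆ys-x z∈xs = ∈-filter⁺ x≢? (xs⊆ys (there z∈xs)) (All.lookup x∉xs z∈xs)

length-filter-∈?-∷ : ∀ {k m} s (p : Subset m) (f : Fin k → Fin m) →
  length (filter (_∈? (s ∷ p)) (tabulateˡ (Fin.suc ∘ f))) ≡ length (filter (_∈? p) (tabulateˡ f))
length-filter-∈?-∷ {zero}  s p f = refl
length-filter-∈?-∷ {suc k} s p f with f Fin.zero ∈? p
... | yes _ = cong suc (length-filter-∈?-∷ s p (f ∘ Fin.suc))
... | no  _ = length-filter-∈?-∷ s p (f ∘ Fin.suc)

∣p∣≡length-filter-allFin : ∀ {m} (p : Subset m) → ∣ p ∣ ≡ length (filter (_∈? p) (allFin m))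
∣p∣≡length-filter-allFin []            = refl
∣p∣≡length-filter-allFin (inside ∷ p)  =
  cong suc (trans (∣p∣≡length-filter-allFin p) (sym (length-filter-∈?-∷ inside p id)))
∣p∣≡length-filter-allFin (outside ∷ p) =
  trans (∣p∣≡length-filter-allFin p) (sym (length-filter-∈?-∷ outside p id))

∣p∣≤length : ∀ {m} (p : Subset m) {ys : List (Fin m)} → (∀ {x} → x ∈ p → x ∈ˡ ys) →
             ∣ p ∣ ≤ length ys
∣p∣≤length {m} p p⊆ys =
  subst (_≤ _) (sym (∣p∣≡length-filter-allFin p))
    (Unique-⊆⇒length≤ _≟_ (filter⁺ (_∈? p) (allFin⁺ m))
      (λ x∈ → p⊆ys (proj₂ (∈-filter⁻ (_∈? p) {xs = allFin m} x∈))))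

first-positive : ∀ {p} {P : ℕ → Set p} → Decidable P → ∀ N → P (suc N) →
                 ∃[ k ] (0 < k × P k × (∀ i → 0 < i → i < k → ¬ P i))
first-positive P? N _ with P? 1
... | yes P1 = 1 , z<s , P1 , λ { _ (s≤s z≤n) (s≤s ()) }
first-positive P? zero    P1 | no ¬P1 = contradiction P1 ¬P1
first-positive {P = P} P? (suc N) PN | no ¬P1 with first-positive (P? ∘ suc) N PN
... | k , _ , Pk , none = suc k , z<s , Pk , none′
  where
  none′ : ∀ i → 0 < i → i < suc k → ¬ P i
  none′ 1             _ _         = ¬P1
  none′ (suc (suc i)) _ (s≤s i<k) = none (suc i) z<s i<k

module RotationSystem (M : Map) where
  open Map M

  tail-iter-rot : ∀ k e → tail (iter rot k e) ≡ tail e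
  tail-iter-rot zero    e = refl
  tail-iter-rot (suc k) e = trans (rot-tail (iter rot k e)) (tail-iter-rot k e)

  iter-rot-rot : ∀ k e → iter rot k (rot e) ≡ iter rot (suc k) e
  iter-rot-rot zero    e = refl
  iter-rot-rot (suc k) e = cong rot (iter-rot-rot k e)

  face-φ : ∀ e → face (φ e) ≡ face e
  face-φ e = sym (from (face-orb e (φ e)) (1 , refl))

  face-rot : ∀ e → face (rot e) ≡ face (inv e)
  face-rot e = subst (λ e′ → face (rot e′) ≡ face (inv e)) (inv-invol e) (face-φ (inv e))

  dart-at-InVF : ∀ {Y v} → InVF M Y v → ∃[ a ] (tail a ≡ v × face a ∈ Y)
  dart-at-InVF     (e , e∈Y , inj₁ tail≡v) = e , tail≡v , e∈Y
  dart-at-InVF {Y} (e , e∈Y , inj₂ head≡v) =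
    φ e , trans (rot-tail (inv e)) head≡v , subst (_∈ Y) (sym (face-φ e)) e∈Y

  module KDarts (K : Subset d) (K-sym : EdgeSet M K) where

    KFree : Fin d → ℕ → Set
    KFree x k = ∀ i → 0 < i → i < k → iter rot i x ∉ K

    KFree-1 : ∀ x → KFree x 1
    KFree-1 x _ (s≤s z≤n) (s≤s ())

    KFree-mono : ∀ {x j k} → j ≤ k → KFree x k → KFree x j
    KFree-mono j≤k free i 0<i i<j = free i 0<i (≤-trans i<j j≤k)

    KFree-extend : ∀ {x k} → KFree x k → iter rot k x ∉ K → KFree x (suc k)
    KFree-extend free x∉K i 0<i i<1+k with m<1+n⇒m<n∨m≡n i<1+k
    ... | inj₁ i<k  = free i 0<i i<k
    ... | inj₂ refl = x∉K

    K-dart-at : ∀ {v} → InVK M K v → ∃[ f ] (f ∈ K × tail f ≡ v)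
    K-dart-at (e , e∈K , inj₁ tail≡v) = e , e∈K , tail≡v
    K-dart-at (e , e∈K , inj₂ head≡v) = inv e , to (K-sym e) e∈K , head≡v

    next-K-dart : ∀ {x y} → y ∈ K → tail y ≡ tail x → ∃ (RotKSteps M K x)
    next-K-dart {x} {y} y∈K ty≡tx with rot-cyc (rot x) y (trans (rot-tail x) (sym ty≡tx))
    ... | p , cycle =
      first-positive (λ i → iter rot i x ∈? K) p
        (subst (_∈ K) (trans (sym cycle) (iter-rot-rot p x)) y∈K)

    last-K-dart : ∀ j {f} → f ∈ K → iter rot (suc j) f ∉ K →
      ∃[ x ] ∃[ m ] (x ∈ K × iter rot (suc m) x ≡ iter rot (suc j) f × KFree x (suc (suc m)))
    last-K-dart zero {f} f∈K y∉K = f , 0 , f∈K , refl , KFree-extend (KFree-1 f) y∉K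
    last-K-dart (suc j) {f} f∈K y∉K with iter rot (suc j) f ∈? K
    ... | yes x∈K = _ , 0 , x∈K , refl , KFree-extend (KFree-1 _) y∉K
    ... | no  x∉K with last-K-dart j f∈K x∉K
    ...   | x , m , x∈K , eq , free =
      x , suc m , x∈K , cong rot eq , KFree-extend free (subst (_∉ K) (sym (cong rot eq)) y∉K)

    between-intro : ∀ {x k j} → x ∈ K → RotKSteps M K x k → 0 < j → j < k →
                    Between M K (inv x) (iter rot k x) (iter rot j x)
    between-intro {x} {k} {j} x∈K steps 0<j j<k rewrite inv-invol x =
      to (K-sym x) x∈K , k , j , steps , refl , 0<j , j<k , refl

    dart-in-angle : ∀ {y} → y ∉ K → InVK M K (tail y) → ∃[ e′ ] ∃[ e″ ] Between M K e′ e″ y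
    dart-in-angle {y} y∉K y∈VK with K-dart-at y∈VK
    ... | f , f∈K , tf≡ty with rot-cyc f y tf≡ty
    ...   | zero  , f≡y = contradiction (subst (_∈ K) f≡y f∈K) y∉K
    ...   | suc j , f↦y with last-K-dart j f∈K (subst (_∉ K) (sym f↦y) y∉K)
    ...     | x , m , x∈K , eq , free with next-K-dart {x} x∈K refl
    ...       | k , steps@(0<k , x′∈K , _) =
      _ , _ , subst (Between M K (inv x) (iter rot k x)) (trans eq f↦y)
                (between-intro x∈K steps z<s (≰⇒> (λ k≤1+m → free k 0<k (s≤s k≤1+m) x′∈K)))

    tail-between : ∀ {e′ e″ y} → Between M K e′ e″ y → tail y ≡ head e′
    tail-between {e′} (_ , _ , j , _ , _ , _ , _ , eq) =
      trans (cong tail (sym eq)) (tail-iter-rot j (inv e′))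

module Colouring (M : Map) (K : Subset (Map.d M)) (X : Subset (Map.nf M))
                 (K-sym : EdgeSet M K) (cut : DualCut M K X) where
  open Map M
  open RotationSystem M
  open KDarts K K-sym
  open ≡-Reasoning

  colour : Fin d → Bool
  colour e = lookup X (face e)

  colour⇒∈ : ∀ {e} → colour e ≡ true → face e ∈ X
  colour⇒∈ {e} = lookup⇒[]= (face e) X

  ∈⇒colour : ∀ {e} → face e ∈ X → colour e ≡ true
  ∈⇒colour = []=⇒lookup

  ∉⇒colour : ∀ {e} → face e ∉ X → colour e ≡ false
  ∉⇒colour fe∉X = ¬-not (fe∉X ∘ colour⇒∈)

  colour⇒∉ : ∀ {e} → colour e ≡ false → face e ∉ X
  colour⇒∉ ce≡false fe∈X with trans (sym (∈⇒colour fe∈X)) ce≡false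
  ... | ()

  colour-inv-∈K : ∀ {e} → e ∈ K → colour (inv e) ≡ not (colour e)
  colour-inv-∈K {e} e∈K with to (cut e) e∈K
  ... | inj₁ (fe∈X , fie∉X) = trans (∉⇒colour fie∉X) (cong not (sym (∈⇒colour fe∈X)))
  ... | inj₂ (fe∉X , fie∈X) = trans (∈⇒colour fie∈X) (cong not (sym (∉⇒colour fe∉X)))

  colour-inv-∉K : ∀ {e} → e ∉ K → colour (inv e) ≡ colour e
  colour-inv-∉K {e} e∉K with colour e in ce | colour (inv e) in cie
  ... | true  | true  = refl
  ... | false | false = refl
  ... | true  | false = contradiction (from (cut e) (inj₁ (colour⇒∈ ce , colour⇒∉ cie))) e∉K
  ... | false | true  = contradiction (from (cut e) (inj₂ (colour⇒∉ ce , colour⇒∈ cie))) e∉K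

  colour-rot-∉K : ∀ {e} → e ∉ K → colour (rot e) ≡ colour e
  colour-rot-∉K {e} e∉K = trans (cong (lookup X) (face-rot e)) (colour-inv-∉K e∉K)

  colour-across : ∀ m {x} → KFree x (suc m) → colour (iter rot (suc m) x) ≡ colour (inv x)
  colour-across zero    {x} _    = cong (lookup X) (face-rot x)
  colour-across (suc m) {x} free = begin
    colour (rot (iter rot (suc m) x))  ≡⟨ colour-rot-∉K (free (suc m) z<s ≤-refl) ⟩
    colour (iter rot (suc m) x)        ≡⟨ colour-across m (KFree-mono (n≤1+n _) free) ⟩
    colour (inv x)                     ∎

  colour-between : ∀ {e′ e″ y} → Between M K e′ e″ y → colour y ≡ colour e′
  colour-between (_ , _ , zero , _ , _ , () , _)
  colour-between {e′} {y = y} (_ , _ , suc j , (_ , _ , free) , _ , _ , j<k , rot^j≡y) = begin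
    colour y                            ≡⟨ cong colour (sym rot^j≡y) ⟩
    colour (iter rot (suc j) (inv e′))  ≡⟨ colour-across j (KFree-mono (<⇒≤ j<k) free) ⟩
    colour (inv (inv e′))               ≡⟨ cong colour (inv-invol e′) ⟩
    colour e′                           ∎

  sides-of-K : ∀ e → e ∈ K →
    (face e ∈ X × face (inv e) ∈ ∁ X) ⊎ (face e ∈ ∁ X × face (inv e) ∈ X)
  sides-of-K e e∈K with to (cut e) e∈K
  ... | inj₁ (fe∈X , fie∉X) = inj₁ (fe∈X , x∉p⇒x∈∁p fie∉X)
  ... | inj₂ (fe∉X , fie∈X) = inj₂ (x∉p⇒x∈∁p fe∉X , fie∈X)

  AvoidsVK : Fin n → Set
  AvoidsVK v = ¬ InVK M K v

  colour-iter-rot : ∀ {a} → AvoidsVK (tail a) → ∀ k → colour (iter rot k a) ≡ colour a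
  colour-iter-rot         _     zero    = refl
  colour-iter-rot {a} a∉VK (suc k) =
    trans (colour-rot-∉K (λ x∈K → a∉VK (_ , x∈K , inj₁ (tail-iter-rot k a)))) (colour-iter-rot a∉VK k)

  colour-at-vertex : ∀ {v a b} → AvoidsVK v → tail a ≡ v → tail b ≡ v → colour a ≡ colour b
  colour-at-vertex {a = a} {b} v∉VK refl tb≡ta with rot-cyc a b (sym tb≡ta)
  ... | k , rot^k≡b = trans (sym (colour-iter-rot v∉VK k)) (cong colour rot^k≡b)

  colour-along : ∀ {u w} (p : Walk M u w) → AllVerts M AvoidsVK p →
                 ∀ {a b} → tail a ≡ u → tail b ≡ w → colour a ≡ colour b
  colour-along []      ([] u∉VK)            ta tb = colour-at-vertex u∉VK ta tb
  colour-along (e ∷ p) (te∉VK ∷ p-avoids) {a} {b} ta tb = begin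
    colour a        ≡⟨ colour-at-vertex te∉VK ta refl ⟩
    colour e        ≡⟨ sym (colour-inv-∉K (λ e∈K → te∉VK (e , e∈K , inj₁ refl))) ⟩
    colour (inv e)  ≡⟨ colour-along p p-avoids refl tb ⟩
    colour b        ∎

  sides-separated : ∀ {v v′} → InVF M X v → InVF M (∁ X) v′ →
                    ¬ (Σ (Walk M v v′) λ p → AllVerts M AvoidsVK p)
  sides-separated v∈VX v′∈VX̄ (p , p-avoids) with dart-at-InVF v∈VX | dart-at-InVF v′∈VX̄
  ... | a , ta , fa∈X | b , tb , fb∈∁X =
    x∈∁p⇒x∉p fb∈∁X (colour⇒∈ (trans (sym (colour-along p p-avoids ta tb)) (∈⇒colour fa∈X)))

  VK-cut-set : (∃[ v ] ∃[ v′ ] (AvoidsVK v × AvoidsVK v′ × InVF M X v × InVF M (∁ X) v′)) →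
               IsCutSet M (InVK M K)
  VK-cut-set (v , v′ , v∉VK , v′∉VK , v∈VX , v′∈VX̄) =
    v , v′ , v∉VK , v′∉VK , sides-separated v∈VX v′∈VX̄

  Z : Subset d
  Z = K ∩ tabulate colour

  ∈Z⁺ : ∀ {e} → e ∈ K → colour e ≡ true → e ∈ Z
  ∈Z⁺ {e} e∈K ce = x∈p∩q⁺ (e∈K , lookup⇒[]= e _ (trans (lookup∘tabulate colour e) ce))

  ∈Z⁻ : ∀ {e} → e ∈ Z → e ∈ K × colour e ≡ true
  ∈Z⁻ {e} e∈Z with x∈p∩q⁻ K _ e∈Z
  ... | e∈K , e∈C = e∈K , trans (sym (lookup∘tabulate colour e)) ([]=⇒lookup e∈C)

  Z⊆K : Z ⊆ K
  Z⊆K = proj₁ ∘ ∈Z⁻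

  Z-orients-K : ∀ e → e ∈ K → e ∈ Z ⊎ inv e ∈ Z
  Z-orients-K e e∈K with colour e in ce
  ... | true  = inj₁ (∈Z⁺ e∈K ce)
  ... | false = inj₂ (∈Z⁺ (to (K-sym e) e∈K) (trans (colour-inv-∈K e∈K) (cong not ce)))

  Z-antisym : ∀ e → e ∈ Z → inv e ∉ Z
  Z-antisym e e∈Z ie∈Z
    with trans (sym (proj₂ (∈Z⁻ ie∈Z))) (trans (colour-inv-∈K (Z⊆K e∈Z)) (cong not (proj₂ (∈Z⁻ e∈Z))))
  ... | ()

  Z-angle-closed : ∀ e′ e″ → e′ ∈ Z → AngleK M K e′ e″ → e″ ∈ Z
  Z-angle-closed e′ e″ e′∈Z (_ , zero , (() , _) , _)
  Z-angle-closed e′ e″ e′∈Z (_ , suc m , (_ , e″∈K , free) , refl) = ∈Z⁺ e″∈K (begin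
    colour (iter rot (suc m) (inv e′))  ≡⟨ colour-across m free ⟩
    colour (inv (inv e′))               ≡⟨ cong colour (inv-invol e′) ⟩
    colour e′                           ≡⟨ proj₂ (∈Z⁻ e′∈Z) ⟩
    true                                ∎)

  in-angle-of-Z : ∀ {y} → y ∉ K → colour y ≡ true → InVK M K (tail y) →
                  ∃[ e′ ] ∃[ e″ ] (e′ ∈ Z × Between M K e′ e″ y)
  in-angle-of-Z y∉K cy y∈VK with dart-in-angle y∉K y∈VK
  ... | e′ , e″ , btw = e′ , e″ , ∈Z⁺ (proj₁ btw) (trans (sym (colour-between btw)) cy) , btw

  left-of-Z : ∀ {e′ e″ y} → e′ ∈ Z → Between M K e′ e″ y → face y ∈ X × InVK M K (tail y)
  left-of-Z {e′} e′∈Z btw =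
    colour⇒∈ (trans (colour-between btw) (proj₂ (∈Z⁻ e′∈Z))) ,
    (e′ , proj₁ btw , inj₂ (sym (tail-between btw)))

  InEF-of-K : ∀ {e} → e ∈ K → InEF M X e
  InEF-of-K {e} e∈K with to (cut e) e∈K
  ... | inj₁ (fe∈X , _)  = inj₁ fe∈X
  ... | inj₂ (_ , fie∈X) = inj₂ fie∈X

  colour-InEF-∉K : ∀ {e} → e ∉ K → InEF M X e → colour e ≡ true
  colour-InEF-∉K _   (inj₁ fe∈X)  = ∈⇒colour fe∈X
  colour-InEF-∉K e∉K (inj₂ fie∈X) = trans (sym (colour-inv-∉K e∉K)) (∈⇒colour fie∈X)

  left-of-Z⇔ : ∀ e → (InEF M X e × (InVK M K (tail e) ⊎ InVK M K (head e)))
                     ⇔ (e ∈ K ⊎ ∃[ e′ ] ∃[ e″ ]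
                          (e′ ∈ Z × (Between M K e′ e″ e ⊎ Between M K e′ e″ (inv e))))
  left-of-Z⇔ e = mk⇔ incident⇒left left⇒incident
    where
    incident⇒left : InEF M X e × (InVK M K (tail e) ⊎ InVK M K (head e)) →
                    e ∈ K ⊎ ∃[ e′ ] ∃[ e″ ] (e′ ∈ Z × (Between M K e′ e″ e ⊎ Between M K e′ e″ (inv e)))
    incident⇒left (e∈EX , _) with e ∈? K
    ... | yes e∈K = inj₁ e∈K
    incident⇒left (e∈EX , inj₁ te∈VK) | no e∉K
      with in-angle-of-Z e∉K (colour-InEF-∉K e∉K e∈EX) te∈VK
    ... | e′ , e″ , e′∈Z , btw = inj₂ (e′ , e″ , e′∈Z , inj₁ btw)
    incident⇒left (e∈EX , inj₂ he∈VK) | no e∉K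
      with in-angle-of-Z (e∉K ∘ from (K-sym e))
             (trans (colour-inv-∉K e∉K) (colour-InEF-∉K e∉K e∈EX)) he∈VK
    ... | e′ , e″ , e′∈Z , btw = inj₂ (e′ , e″ , e′∈Z , inj₂ btw)

    left⇒incident : e ∈ K ⊎ ∃[ e′ ] ∃[ e″ ] (e′ ∈ Z × (Between M K e′ e″ e ⊎ Between M K e′ e″ (inv e))) →
                    InEF M X e × (InVK M K (tail e) ⊎ InVK M K (head e))
    left⇒incident (inj₁ e∈K) = InEF-of-K e∈K , inj₁ (e , e∈K , inj₁ refl)
    left⇒incident (inj₂ (_ , _ , e′∈Z , inj₁ btw)) with left-of-Z e′∈Z btw
    ... | fe∈X , te∈VK = inj₁ fe∈X , inj₁ te∈VK
    left⇒incident (inj₂ (_ , _ , e′∈Z , inj₂ btw)) with left-of-Z e′∈Z btw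
    ... | fie∈X , he∈VK = inj₂ fie∈X , inj₂ he∈VK

  Z-dart-at : ∀ {v} → InVK M K v → ∃[ z ] (z ∈ Z × tail z ≡ v)
  Z-dart-at v∈VK with K-dart-at v∈VK
  ... | f , f∈K , tf≡v with colour f in cf
  ...   | true  = f , ∈Z⁺ f∈K cf , tf≡v
  ...   | false with next-K-dart {f} f∈K refl
  ...     | zero  , () , _
  ...     | suc m , _ , y∈K , free =
    _ , ∈Z⁺ y∈K (trans (colour-across m free) (trans (colour-inv-∈K f∈K) (cong not cf))) ,
    trans (tail-iter-rot (suc m) f) tf≡v

  edges : List (Fin d)
  edges = filter (λ e → (e ∈? K) ×-dec (toℕ e <? toℕ (inv e))) (allFin d)

  ∈edges : ∀ {e} → e ∈ K → toℕ e < toℕ (inv e) → e ∈ˡ edges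
  ∈edges {e} e∈K e<ie = ∈-filter⁺ (λ e → (e ∈? K) ×-dec (toℕ e <? toℕ (inv e))) (∈-allFin e) (e∈K , e<ie)

  Z-tail : Fin d → Fin n
  Z-tail e = if colour e then tail e else head e

  Z-tail-when : ∀ {e} b → colour e ≡ b → Z-tail e ≡ (if b then tail e else head e)
  Z-tail-when {e} _ = cong (λ b → if b then tail e else head e)

  tail-Z∈Z-tail-edges : ∀ {z} → z ∈ Z → tail z ∈ˡ map Z-tail edges
  tail-Z∈Z-tail-edges {z} z∈Z with ∈Z⁻ z∈Z | <-cmp (toℕ z) (toℕ (inv z))
  ... | z∈K , cz | tri< z<iz _ _ =
    subst (_∈ˡ map Z-tail edges) (Z-tail-when true cz) (∈-map⁺ Z-tail (∈edges z∈K z<iz))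
  ... | _ | tri≈ _ z≡iz _ = contradiction (cong tail (sym (toℕ-injective z≡iz))) (no-loop z)
  ... | z∈K , cz | tri> _ _ iz<z =
    subst (_∈ˡ map Z-tail edges)
      (trans (Z-tail-when false (trans (colour-inv-∈K z∈K) (cong not cz))) (cong tail (inv-invol z)))
      (∈-map⁺ Z-tail (∈edges (to (K-sym z) z∈K) (subst (λ w → toℕ (inv z) < toℕ w) (sym (inv-invol z)) iz<z)))

  ∣VK∣≤∣K∣ : ∀ (S : Subset n) → (∀ v → (v ∈ S) ⇔ InVK M K v) → ∣ S ∣ ≤ numEdges M K
  ∣VK∣≤∣K∣ S S≡VK = subst (∣ S ∣ ≤_) (length-map Z-tail edges) (∣p∣≤length S covered)
    where
    covered : ∀ {v} → v ∈ S → v ∈ˡ map Z-tail edges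
    covered {v} v∈S with Z-dart-at (to (S≡VK v) v∈S)
    ... | z , z∈Z , refl = tail-Z∈Z-tail-edges z∈Z

lemma1 : (M : Map) → Connected M → DualSimple M →
    (K : Subset (Map.d M)) → EdgeSet M K → DualSeparating M K →
    (X : Subset (Map.nf M)) → DualCut M K X →
    let open Map M in
    -- (i)
    (∀ e → e ∈ K →
      (face e ∈ X × face (inv e) ∈ ∁ X) ⊎ (face e ∈ ∁ X × face (inv e) ∈ X))
    -- (ii)
    × ((∀ v v' → ¬ InVK M K v → ¬ InVK M K v' → InVF M X v → InVF M (∁ X) v' →
         ¬ (Σ (Walk M v v') λ p → AllVerts M (λ x → ¬ InVK M K x) p))
       × ((∃[ v ] ∃[ v' ] (¬ InVK M K v × ¬ InVK M K v' × InVF M X v × InVF M (∁ X) v'))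
          → IsCutSet M (InVK M K)))
    -- (iii)
    × (∃[ Z ] ((Z ⊆ K)
        × (∀ e → e ∈ K → e ∈ Z ⊎ inv e ∈ Z)
        × (∀ e → e ∈ Z → inv e ∉ Z)
        × (∀ e' e'' → e' ∈ Z → AngleK M K e' e'' → e'' ∈ Z)
        × (∀ e → (InEF M X e × (InVK M K (tail e) ⊎ InVK M K (head e)))
                 ⇔ (e ∈ K ⊎ ∃[ e' ] ∃[ e'' ]
                      (e' ∈ Z × (Between M K e' e'' e ⊎ Between M K e' e'' (inv e)))))))
    -- (iv)
    × (∀ (S : Subset n) → (∀ v → (v ∈ S) ⇔ InVK M K v) → ∣ S ∣ ≤ numEdges M K)
lemma1 M _ _ K K-sym _ X cut =
  sides-of-K ,
  ((λ _ _ _ _ → sides-separated) , VK-cut-set) ,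
  (Z , Z⊆K , Z-orients-K , Z-antisym , Z-angle-closed , left-of-Z⇔) ,
  ∣VK∣≤∣K∣
  where open Colouring M K X K-sym cut
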